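{- Let $z$ and $p$ be positive integers and let $n > 16z^2p^2$ be a perfect square. Then any special cover of the path on $n$ vertices by balls of pairwise distinct radii, each radius at most $\sqrt{n}-1$, has at least $zp$ non-tiny balls entirely contained in the $\lfloor n/2 \rfloor$ rightmost vertices of the path.
   Context: A ball of radius $r$ centered at a vertex $v_i$ of a path $(v_1,\dots,v_n)$ is the set of vertices at distance at most $r$ from $v_i$; its left and right endpoints are $v_{i-r}$ and $v_{i+r}$. Balls are ordered left to right by their centers. A cover is a collection of balls whose union is all vertices. A ball is tiny if its radius is less than $p$ and non-tiny otherwise. A cover is special if there is a sequence of its balls $B_1,\dots,B_s$ with $B_1$ the leftmost ball such that: consecutive non-tiny balls have increasing radii; for each $i$ the left endpoint of $B_{i+1}$ is the vertex immediately after the right endpoint of $B_i$ (non-overlapping); the tiny balls are contiguous; and every vertex is covered by some $B_i$. -}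

module Defs where

open import Data.Nat using (ℕ; zero; suc; _+_; _*_; _∸_; _≤_; _<_; ⌊_/2⌋)
open import Data.Nat.Properties using (_≤?_; _<?_)
open import Data.Product using (_×_; Σ; ∃; _,_)
open import Data.List using (List; filter; length)
open import Data.List.Membership.Propositional using (_∈_)
open import Data.List.Relation.Unary.All using (All)
open import Data.List.Relation.Unary.Any using (Any)
open import Data.List.Relation.Unary.AllPairs using (AllPairs)
open import Relation.Binary.PropositionalEquality using (_≡_; _≢_)
open import Relation.Nullary using (Dec; ¬_)
open import Relation.Nullary.Decidable using (_×-dec_)

-- The path (v_1, ..., v_n): vertex v_i is represented by the natural number i, 1 ≤ i ≤ n.

record Ball : Set where
  constructor ball
  field
    center : ℕ
    radius : ℕ
open Ball public

left : Ball → ℕ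
left b = center b ∸ radius b

right : Ball → ℕ
right b = center b + radius b

ValidBall : ℕ → Ball → Set
ValidBall n b = (1 ≤ left b) × (radius b ≤ center b) × (right b ≤ n)

_∈B_ : ℕ → Ball → Set
v ∈B b = (left b ≤ v) × (v ≤ right b)

IsCover : ℕ → List Ball → Set
IsCover n C = ∀ v → 1 ≤ v → v ≤ n → Any (v ∈B_) C

Tiny : ℕ → Ball → Set
Tiny p b = radius b < p

NonTiny : ℕ → Ball → Set
NonTiny p b = ¬ (radius b < p)

-- A special cover (sequence B_1,...,B_s is represented as B 0, ..., B (s-1)).
IsSpecial : ℕ → ℕ → List Ball → Set
IsSpecial n p C =
  Σ ℕ λ s → Σ (ℕ → Ball) λ B →
    (1 ≤ s)
  × (∀ i → i < s → B i ∈ C)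
  × (∀ b → b ∈ C → center (B 0) ≤ center b)
  × (∀ i j → i < j → j < s → NonTiny p (B i) → NonTiny p (B j) →
       (∀ k → i < k → k < j → Tiny p (B k)) → radius (B i) < radius (B j))
  × (∀ i → suc i < s → left (B (suc i)) ≡ suc (right (B i)))
  × (∀ i k j → i < k → k < j → j < s → Tiny p (B i) → Tiny p (B j) → Tiny p (B k))
  × (∀ v → 1 ≤ v → v ≤ n → Σ ℕ λ i → (i < s) × (v ∈B B i))

NonTinyRight : ℕ → ℕ → Ball → Set
NonTinyRight n p b = NonTiny p b × (n ∸ ⌊ n /2⌋ < left b) × (right b ≤ n)

nonTinyRight? : ∀ n p b → Dec (NonTinyRight n p b)
nonTinyRight? n p b =
  Relation.Nullary.Decidable.¬? (radius b <? p) ×-dec ((n ∸ ⌊ n /2⌋ <? left b) ×-dec (right b ≤? n))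

countNonTinyRight : ℕ → ℕ → List Ball → ℕ
countNonTinyRight n p C = length (filter (nonTinyRight? n p) C)

-- Let B_t be the ball of the special sequence that contains the first vertex of the right half.
-- The balls B_t, B_t+1, ... are consecutive and reach vertex n, so their sizes 2r + 1 add up to at
-- least ⌊n/2⌋. Their radii are distinct: the tiny ones are below p and contribute at most p², and
-- c non-tiny ones are below m = √n and contribute at most m² - (m - c)². As m > 4zp, this forces
-- c > zp. All of these non-tiny balls except possibly B_t lie in the right half.
{-# OPTIONS --safe #-}
module Submission where

open import Algebra.Properties.CommutativeSemigroup using (x∙yz≈y∙xz)
open import Data.Nat using (ℕ; zero; suc; _+_; _*_; _∸_; _≤_; _<_; _≤′_; ≤′-refl; ≤′-step; z≤n; s≤s; z<s; s≤s⁻¹; _≟_; ⌊_/2⌋; >-nonZero)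
open import Data.Nat.ListAction using (sum)
open import Data.Nat.Properties
open import Data.Nat.Tactic.RingSolver using (solve-∀)
open import Data.List using (List; []; _∷_; length; map; filter; upTo; applyUpTo)
open import Data.List.Properties using (length-map; length-removeAt′; length-upTo; map-∘)
open import Data.List.Membership.Propositional using (_∈_)
open import Data.List.Membership.Propositional.Properties using (∈-upTo⁺; ∈-filter⁺; ∈-filter⁻)
open import Data.List.Membership.DecPropositional _≟_ using (_∈?_)
open import Data.List.Relation.Binary.Subset.Propositional using (_⊆_)
open import Data.List.Relation.Unary.All as All using (All; _∷_)
open import Data.List.Relation.Unary.All.Properties as All using (─⁺; ¬Any⇒All¬; all-filter)
open import Data.List.Relation.Unary.AllPairs as AllPairs using (AllPairs; _∷_)
import Data.List.Relation.Unary.AllPairs.Properties as AllPairs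
open import Data.List.Relation.Unary.Any using (here; there; index; _─_)
open import Data.List.Relation.Unary.Unique.Propositional using (Unique)
open import Data.Product using (_×_; _,_; proj₁; proj₂)
open import Function using (_∘_)
open import Relation.Binary.PropositionalEquality using (_≡_; _≢_; refl; sym; trans; cong; cong₂; subst; ≢-sym; module ≡-Reasoning)
open import Relation.Nullary using (Dec; yes; no; ¬?; contradiction)
open import Relation.Unary using (Decidable)

open import Defs

module _ {A : Set} where

  ∈-─⁺ : ∀ {x y : A} {xs} (x∈xs : x ∈ xs) → x ≢ y → y ∈ xs → y ∈ (xs ─ x∈xs)
  ∈-─⁺ (here refl)  x≢y (here refl)  = contradiction refl x≢y
  ∈-─⁺ (here refl)  _   (there y∈xs) = y∈xs
  ∈-─⁺ (there _)    _   (here refl)  = here refl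
  ∈-─⁺ (there x∈xs) x≢y (there y∈xs) = there (∈-─⁺ x∈xs x≢y y∈xs)

  AllPairs-─⁺ : ∀ {R : A → A → Set} {x : A} {xs} (x∈xs : x ∈ xs) → AllPairs R xs → AllPairs R (xs ─ x∈xs)
  AllPairs-─⁺ (here _)     (_ ∷ rxs)  = rxs
  AllPairs-─⁺ (there x∈xs) (rx ∷ rxs) = ─⁺ x∈xs rx ∷ AllPairs-─⁺ x∈xs rxs

  Unique-─⇒∉ : ∀ {x : A} {xs} (x∈xs : x ∈ xs) → Unique xs → All (x ≢_) (xs ─ x∈xs)
  Unique-─⇒∉ (here refl)  (x∉xs ∷ _)   = x∉xs
  Unique-─⇒∉ (there x∈xs) (y∉xs ∷ xs!) = ≢-sym (All.lookup y∉xs x∈xs) ∷ Unique-─⇒∉ x∈xs xs!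

  Unique-⊆⇒length≤ : ∀ {xs ys : List A} → Unique xs → xs ⊆ ys → length xs ≤ length ys
  Unique-⊆⇒length≤ {[]}          _            _     = z≤n
  Unique-⊆⇒length≤ {x ∷ xs} {ys} (x∉xs ∷ xs!) xs⊆ys = begin
    suc (length xs)           ≤⟨ s≤s (Unique-⊆⇒length≤ xs! xs⊆ys─x) ⟩
    suc (length (ys ─ x∈ys))  ≡⟨ length-removeAt′ ys (index x∈ys) ⟨
    length ys                 ∎
    where
    open ≤-Reasoning
    x∈ys = xs⊆ys (here refl)
    xs⊆ys─x : xs ⊆ (ys ─ x∈ys)
    xs⊆ys─x y∈xs = ∈-─⁺ x∈ys (All.lookup x∉xs y∈xs) (xs⊆ys (there y∈xs))

  AllPairs-≢-injective : ∀ {Y : Set} (f : A → Y) {xs x y} → AllPairs (λ a b → f a ≢ f b) xs →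
    x ∈ xs → y ∈ xs → f x ≡ f y → x ≡ y
  AllPairs-≢-injective f _          (here refl)  (here refl)  _     = refl
  AllPairs-≢-injective f (fx≢ ∷ _)  (here refl)  (there y∈xs) fx≡fy = contradiction fx≡fy (All.lookup fx≢ y∈xs)
  AllPairs-≢-injective f (fy≢ ∷ _)  (there x∈xs) (here refl)  fx≡fy = contradiction (sym fx≡fy) (All.lookup fy≢ x∈xs)
  AllPairs-≢-injective f (_ ∷ fxs!) (there x∈xs) (there y∈xs) = AllPairs-≢-injective f fxs! x∈xs y∈xs

  sum-map-filter : ∀ (f : A → ℕ) {P : A → Set} (P? : Decidable P) xs →
    sum (map f xs) ≡ sum (map f (filter P? xs)) + sum (map f (filter (¬? ∘ P?) xs))
  sum-map-filter f P? [] = refl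
  sum-map-filter f P? (x ∷ xs) with P? x
  ... | yes _ = trans (cong (f x +_) (sum-map-filter f P? xs)) (sym (+-assoc (f x) _ _))
  ... | no  _ = trans (cong (f x +_) (sum-map-filter f P? xs))
                      (x∙yz≈y∙xz +-commutativeSemigroup (f x) (sum (map f (filter P? xs))) _)

  sum-map-─ : ∀ (f : A → ℕ) {x xs} (x∈xs : x ∈ xs) → sum (map f xs) ≡ f x + sum (map f (xs ─ x∈xs))
  sum-map-─ f (here refl) = refl
  sum-map-─ f {x} {y ∷ xs} (there x∈xs) =
    trans (cong (f y +_) (sum-map-─ f x∈xs)) (x∙yz≈y∙xz +-commutativeSemigroup (f y) (f x) _)

size : ℕ → ℕ
size r = suc (r + r)

<1+∧≢⇒< : ∀ {M r} → r < suc M × M ≢ r → r < M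
<1+∧≢⇒< (s≤s r≤M , M≢r) = ≤∧≢⇒< r≤M (≢-sym M≢r)

Unique-<⇒length≤ : ∀ {M rs} → Unique rs → All (_< M) rs → length rs ≤ M
Unique-<⇒length≤ {M} {rs} rs! rs<M = begin
  length rs       ≤⟨ Unique-⊆⇒length≤ rs! (λ r∈rs → ∈-upTo⁺ (All.lookup rs<M r∈rs)) ⟩
  length (upTo M) ≡⟨ length-upTo M ⟩
  M               ∎
  where open ≤-Reasoning

size+square≡square-suc : ∀ M → suc (M + M) + M * M ≡ suc M * suc M
size+square≡square-suc = solve-∀

-- Distinct radii below M are at best M-1, M-2, ..., whose sizes sum to M² - (M - c)².
sum-size-Unique-< : ∀ M {rs} → Unique rs → All (_< M) rs →
  sum (map size rs) + (M ∸ length rs) * (M ∸ length rs) ≤ M * M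
sum-size-Unique-< zero    {[]}    _ _        = z≤n
sum-size-Unique-< zero    {_ ∷ _} _ (() ∷ _)
sum-size-Unique-< (suc M) {rs} rs! rs<1+M with M ∈? rs
... | yes M∈rs = begin
  sum (map size rs) + (suc M ∸ length rs) * (suc M ∸ length rs)
    ≡⟨ cong₂ (λ s l → s + (suc M ∸ l) * (suc M ∸ l)) (sum-map-─ size M∈rs) (length-removeAt′ rs (index M∈rs)) ⟩
  size M + sum (map size rs′) + d * d    ≡⟨ +-assoc (size M) _ _ ⟩
  size M + (sum (map size rs′) + d * d)  ≤⟨ +-monoʳ-≤ (size M) (sum-size-Unique-< M rs′! rs′<M) ⟩
  size M + M * M                          ≡⟨ size+square≡square-suc M ⟩
  suc M * suc M                           ∎
  where
  open ≤-Reasoning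
  rs′ = rs ─ M∈rs
  d = M ∸ length rs′
  rs′! : Unique rs′
  rs′! = AllPairs-─⁺ M∈rs rs!
  rs′<M : All (_< M) rs′
  rs′<M = All.zipWith <1+∧≢⇒< (─⁺ M∈rs rs<1+M , Unique-─⇒∉ M∈rs rs!)
... | no M∉rs = begin
  sum (map size rs) + (suc M ∸ length rs) * (suc M ∸ length rs)
    ≡⟨ cong (λ e → sum (map size rs) + e * e) (+-∸-assoc 1 (Unique-<⇒length≤ rs! rs<M)) ⟩
  sum (map size rs) + suc d * suc d      ≡⟨ shift (sum (map size rs)) d ⟩
  size d + (sum (map size rs) + d * d)   ≤⟨ +-mono-≤ (s≤s (+-mono-≤ d≤M d≤M)) (sum-size-Unique-< M rs! rs<M) ⟩
  size M + M * M                          ≡⟨ size+square≡square-suc M ⟩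
  suc M * suc M                           ∎
  where
  open ≤-Reasoning
  rs<M : All (_< M) rs
  rs<M = All.zipWith <1+∧≢⇒< (rs<1+M , ¬Any⇒All¬ rs M∉rs)
  d = M ∸ length rs
  d≤M : d ≤ M
  d≤M = m∸n≤m M (length rs)
  shift : ∀ S d → S + suc d * suc d ≡ suc (d + d) + (S + d * d)
  shift = solve-∀

n≤1+⌊n/2⌋+⌊n/2⌋ : ∀ n → n ≤ suc (⌊ n /2⌋ + ⌊ n /2⌋)
n≤1+⌊n/2⌋+⌊n/2⌋ zero          = z≤n
n≤1+⌊n/2⌋+⌊n/2⌋ (suc zero)    = s≤s z≤n
n≤1+⌊n/2⌋+⌊n/2⌋ (suc (suc n)) =
  s≤s (≤-trans (s≤s (n≤1+⌊n/2⌋+⌊n/2⌋ n)) (≤-reflexive (cong suc (sym (+-suc ⌊ n /2⌋ ⌊ n /2⌋)))))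

m*m<n*n⇒m<n : ∀ {m n} → m * m < n * n → m < n
m*m<n*n⇒m<n {m} {n} mm<nn with m <? n
... | yes m<n = m<n
... | no  m≮n = contradiction mm<nn (≤⇒≯ (*-mono-≤ (≮⇒≥ m≮n) (≮⇒≥ m≮n)))

-- Write m = 4a + 1 + f; then m - a = 3a + 1 + f and 2(m - a)² - m² - 2a² = (1 + f)² + 4a(1 + f).
square-gap : ∀ {a m} → 1 ≤ a → 4 * a < m → m * m + 2 * (a * a) + 1 < 2 * ((m ∸ a) * (m ∸ a))
square-gap {suc a} {m} _ 4a<m with m≤n⇒∃[o]m+o≡n 4a<m
... | f , refl = begin-strict
  m * m + 2 * (A * A) + 1                  <⟨ s≤s (m≤m+n _ _) ⟩
  suc (m * m + 2 * (A * A) + 1 + excess)  ≡⟨ gap a f ⟩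
  2 * (e * e)                              ≡⟨ cong (λ x → 2 * (x * x)) m∸A≡e ⟨
  2 * ((m ∸ A) * (m ∸ A))                  ∎
  where
  open ≤-Reasoning
  A = suc a
  e = suc (3 * A) + f
  excess = f * f + 2 * f + 4 * a + 3 + 4 * A * f
  split : ∀ a f → suc (4 * suc a) + f ≡ suc a + (suc (3 * suc a) + f)
  split = solve-∀
  m∸A≡e : m ∸ A ≡ e
  m∸A≡e = trans (cong (_∸ A) (split a f)) (m+n∸m≡n A e)
  gap : ∀ a f → let A = suc a ; m = suc (4 * A) + f ; e = suc (3 * A) + f in
    suc (m * m + 2 * (A * A) + 1 + (f * f + 2 * f + 4 * a + 3 + 4 * A * f)) ≡ 2 * (e * e)
  gap = solve-∀

volume-bound⇒< : ∀ {a p m c V} → 1 ≤ a → p ≤ a → 4 * a < m →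
  ⌊ m * m /2⌋ ≤ V → V + (m ∸ c) * (m ∸ c) ≤ p * p + m * m → a < c
volume-bound⇒< {a} {p} {m} {c} {V} 1≤a p≤a 4a<m half≤V V+E≤ with a <? c
... | yes a<c = a<c
... | no  a≮c = contradiction chain (<-irrefl refl)
  where
  open ≤-Reasoning
  H = ⌊ m * m /2⌋
  E = (m ∸ c) * (m ∸ c)
  m∸a≤m∸c : m ∸ a ≤ m ∸ c
  m∸a≤m∸c = ∸-monoʳ-≤ m (≮⇒≥ a≮c)
  regroup₁ : ∀ p m → suc (2 * (p * p + m * m)) ≡ m * m + (m * m + 2 * (p * p) + 1)
  regroup₁ = solve-∀
  regroup₂ : ∀ V E → suc (V + V) + 2 * E ≡ suc (2 * (V + E))
  regroup₂ = solve-∀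
  chain : suc (2 * (p * p + m * m)) < suc (2 * (p * p + m * m))
  chain = begin-strict
    suc (2 * (p * p + m * m))               ≡⟨ regroup₁ p m ⟩
    m * m + (m * m + 2 * (p * p) + 1)       ≤⟨ +-monoʳ-≤ (m * m) (+-monoˡ-≤ 1 (+-monoʳ-≤ (m * m) (*-monoʳ-≤ 2 (*-mono-≤ p≤a p≤a)))) ⟩
    m * m + (m * m + 2 * (a * a) + 1)       <⟨ +-monoʳ-< (m * m) (square-gap 1≤a 4a<m) ⟩
    m * m + 2 * ((m ∸ a) * (m ∸ a))         ≤⟨ +-monoʳ-≤ (m * m) (*-monoʳ-≤ 2 (*-mono-≤ m∸a≤m∸c m∸a≤m∸c)) ⟩
    m * m + 2 * E                            ≤⟨ +-monoˡ-≤ (2 * E) (n≤1+⌊n/2⌋+⌊n/2⌋ (m * m)) ⟩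
    suc (H + H) + 2 * E                      ≤⟨ +-monoˡ-≤ (2 * E) (s≤s (+-mono-≤ half≤V half≤V)) ⟩
    suc (V + V) + 2 * E                      ≡⟨ regroup₂ V E ⟩
    suc (2 * (V + E))                        ≤⟨ s≤s (*-monoʳ-≤ 2 V+E≤) ⟩
    suc (2 * (p * p + m * m))                ∎

volume : List Ball → ℕ
volume bs = sum (map (size ∘ radius) bs)

left≤right : ∀ b → left b ≤ right b
left≤right (ball c r) = ≤-trans (m∸n≤m c r) (m≤m+n c r)

left+size≡1+right : ∀ b → radius b ≤ center b → left b + size (radius b) ≡ suc (right b)
left+size≡1+right (ball c r) r≤c = begin
  c ∸ r + suc (r + r)     ≡⟨ +-suc (c ∸ r) (r + r) ⟩
  suc (c ∸ r + (r + r))   ≡⟨ cong suc (+-assoc (c ∸ r) r r) ⟨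
  suc (c ∸ r + r + r)     ≡⟨ cong (λ x → suc (x + r)) (m∸n+n≡m r≤c) ⟩
  suc (c + r)             ∎
  where open ≡-Reasoning

Adjacent : (ℕ → Ball) → ℕ → Set
Adjacent B s = ∀ i → suc i < s → left (B (suc i)) ≡ suc (right (B i))

module _ (B : ℕ → Ball) {s : ℕ} (adj : Adjacent B s) where

  right<left-suc : ∀ {i} → suc i < s → right (B i) < left (B (suc i))
  right<left-suc {i} 1+i<s = ≤-reflexive (sym (adj i 1+i<s))

  right-mono : ∀ {i j} → i ≤ j → j < s → right (B i) ≤ right (B j)
  right-mono i≤j = go (≤⇒≤′ i≤j)
    where
    go : ∀ {i j} → i ≤′ j → j < s → right (B i) ≤ right (B j)
    go ≤′-refl                _     = ≤-refl
    go (≤′-step {j} i≤′j) 1+j<s =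
      ≤-trans (go i≤′j (<⇒≤ 1+j<s)) (<⇒≤ (<-≤-trans (right<left-suc 1+j<s) (left≤right (B (suc j)))))

  right<left : ∀ {i j} → i < j → j < s → right (B i) < left (B j)
  right<left {j = suc j} (s≤s i≤j) j<s = ≤-<-trans (right-mono i≤j (<⇒≤ j<s)) (right<left-suc j<s)

right<left+volume : ∀ {B s j} → Adjacent B s → (∀ {i} → i < s → radius (B i) ≤ center (B i)) → j < s →
  right (B j) < left (B 0) + volume (applyUpTo B s)
right<left+volume {B} {suc s} {zero} _ centred _ = begin-strict
  right (B 0)                                <⟨ ≤-reflexive (sym (left+size≡1+right (B 0) (centred z<s))) ⟩
  left (B 0) + size (radius (B 0))           ≤⟨ +-monoʳ-≤ (left (B 0)) (m≤m+n _ _) ⟩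
  left (B 0) + volume (applyUpTo B (suc s))  ∎
  where open ≤-Reasoning
right<left+volume {B} {suc s} {suc j} adj centred (s≤s j<s) = begin-strict
  right (B (suc j))                                          <⟨ right<left+volume (λ i → adj (suc i) ∘ s≤s) (centred ∘ s≤s) j<s ⟩
  left (B 1) + volume rest                                   ≡⟨ cong (_+ volume rest) (adj 0 (s≤s (≤-trans (s≤s z≤n) j<s))) ⟩
  suc (right (B 0)) + volume rest                            ≡⟨ cong (_+ volume rest) (left+size≡1+right (B 0) (centred z<s)) ⟨
  left (B 0) + size (radius (B 0)) + volume rest             ≡⟨ +-assoc (left (B 0)) _ _ ⟩
  left (B 0) + volume (applyUpTo B (suc s))                  ∎
  where
  open ≤-Reasoning
  rest = applyUpTo (B ∘ suc) s

run-radius≢ : ∀ {C B s} → Adjacent B s → AllPairs (λ a b → radius a ≢ radius b) C → (∀ i → i < s → B i ∈ C) →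
  ∀ {i j} → i < j → j < s → radius (B i) ≢ radius (B j)
run-radius≢ {B = B} adj distinct B∈C {i} {j} i<j j<s ri≡rj =
  contradiction (subst (λ b → left b ≤ right (B i)) Bi≡Bj (left≤right (B i))) (<⇒≱ (right<left B adj i<j j<s))
  where
  Bi≡Bj : B i ≡ B j
  Bi≡Bj = AllPairs-≢-injective radius distinct (B∈C i (<-trans i<j j<s)) (B∈C j j<s) ri≡rj

record RightHalfRun (n : ℕ) (C : List Ball) : Set where
  field
    first          : Ball
    rest           : List Ball
    members        : All (_∈ C) (first ∷ rest)
    radii-distinct : AllPairs (λ a b → radius a ≢ radius b) (first ∷ rest)
    half≤volume    : ⌊ n /2⌋ ≤ volume (first ∷ rest)
    rest-right     : All (λ b → n ∸ ⌊ n /2⌋ < left b × right b ≤ n) rest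

1+n∸⌊n/2⌋≤n : ∀ {n} → 2 ≤ n → suc (n ∸ ⌊ n /2⌋) ≤ n
1+n∸⌊n/2⌋≤n {n} 2≤n = ∸-monoʳ-< (⌊n/2⌋-mono 2≤n) (⌊n/2⌋≤n n)

special⇒rightHalfRun : ∀ {n p C} → 2 ≤ n → All (ValidBall n) C → AllPairs (λ a b → radius a ≢ radius b) C →
  IsSpecial n p C → RightHalfRun n C
special⇒rightHalfRun {n} 2≤n valid distinct (s , B , _ , B∈C , _ , _ , adj , _ , covers)
  with covers (suc (n ∸ ⌊ n /2⌋)) (s≤s z≤n) (1+n∸⌊n/2⌋≤n 2≤n) | covers n (≤-trans (s≤s z≤n) 2≤n) ≤-refl
... | t , t<s , left≤1+h , 1+h≤right | j , j<s , _ , n≤right = record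
  { first          = B t
  ; rest           = applyUpTo (B′ ∘ suc) k
  ; members        = All.applyUpTo⁺₁ B′ (suc k) (λ i<1+k → B∈C _ (shifted i<1+k))
  ; radii-distinct = AllPairs.applyUpTo⁺₁ B′ (suc k)
                       (λ i<j j<1+k → run-radius≢ adj distinct B∈C (+-monoˡ-< t i<j) (shifted j<1+k))
  ; half≤volume    = half≤volume
  ; rest-right     = All.applyUpTo⁺₁ (B′ ∘ suc) k (λ i<k → right-half i<k , proj₂ (proj₂ (valid′ (s≤s i<k))))
  }
  where
  h = n ∸ ⌊ n /2⌋
  k = s ∸ suc t
  B′ : ℕ → Ball
  B′ i = B (i + t)
  1+k+t≡s : suc (k + t) ≡ s
  1+k+t≡s = trans (sym (+-suc k t)) (m∸n+n≡m t<s)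
  shifted : ∀ {i} → i < suc k → i + t < s
  shifted (s≤s i≤k) = ≤-trans (s≤s (+-monoˡ-≤ t i≤k)) (≤-reflexive 1+k+t≡s)
  adj′ : Adjacent B′ (suc k)
  adj′ i 1+i<1+k = adj (i + t) (shifted 1+i<1+k)
  valid′ : ∀ {i} → i < suc k → ValidBall n (B′ i)
  valid′ i<1+k = All.lookup valid (B∈C _ (shifted i<1+k))
  right-half : ∀ {i} → i < k → h < left (B′ (suc i))
  right-half {i} i<k = ≤-trans 1+h≤right (<⇒≤ (right<left B adj (s≤s (m≤n+m t i)) (shifted (s≤s i<k))))
  j≤k+t : j ≤ k + t
  j≤k+t = s≤s⁻¹ (subst (j <_) (sym 1+k+t≡s) j<s)
  half≤volume : ⌊ n /2⌋ ≤ volume (applyUpTo B′ (suc k))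
  half≤volume = +-cancelˡ-≤ h _ _ (s≤s⁻¹ (begin-strict
    h + ⌊ n /2⌋                               ≡⟨ m∸n+n≡m (⌊n/2⌋≤n n) ⟩
    n                                         ≤⟨ n≤right ⟩
    right (B j)                               ≤⟨ right-mono B adj j≤k+t (shifted ≤-refl) ⟩
    right (B′ k)                              <⟨ right<left+volume adj′ (λ i<1+k → proj₁ (proj₂ (valid′ i<1+k))) ≤-refl ⟩
    left (B t) + volume (applyUpTo B′ (suc k)) ≤⟨ +-monoˡ-≤ _ left≤1+h ⟩
    suc h + volume (applyUpTo B′ (suc k))      ∎))
    where open ≤-Reasoning

nonTiny? : ∀ p b → Dec (NonTiny p b)
nonTiny? p b = ¬? (radius b <? p)

volume+[m∸c]²≤p²+m² : ∀ p m bs → AllPairs (λ a b → radius a ≢ radius b) bs → All (λ b → radius b < m) bs →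
  let c = length (filter (nonTiny? p) bs) in volume bs + (m ∸ c) * (m ∸ c) ≤ p * p + m * m
volume+[m∸c]²≤p²+m² p m bs distinct bs<m = begin
  volume bs + E                   ≡⟨ cong (_+ E) (sum-map-filter (size ∘ radius) tiny? bs) ⟩
  volume tiny + volume large + E   ≡⟨ +-assoc (volume tiny) _ _ ⟩
  volume tiny + (volume large + E) ≤⟨ +-mono-≤ tiny≤ large≤ ⟩
  p * p + m * m                    ∎
  where
  open ≤-Reasoning
  tiny? : Decidable (Tiny p)
  tiny? b = radius b <? p
  tiny = filter tiny? bs
  large = filter (nonTiny? p) bs
  E = (m ∸ length large) * (m ∸ length large)
  volume≡ : ∀ bs → volume bs ≡ sum (map size (map radius bs))
  volume≡ bs = cong sum (map-∘ bs)
  tiny≤ : volume tiny ≤ p * p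
  tiny≤ = ≤-trans (≤-reflexive (volume≡ tiny)) (m+n≤o⇒m≤o (sum (map size (map radius tiny)))
    (sum-size-Unique-< p (AllPairs.map⁺ (AllPairs.filter⁺ tiny? distinct)) (All.map⁺ (all-filter tiny? bs))))
  large≤ : volume large + E ≤ m * m
  large≤ = begin
    volume large + E
      ≡⟨ cong₂ (λ v l → v + (m ∸ l) * (m ∸ l)) (volume≡ large) (sym (length-map radius large)) ⟩
    sum (map size (map radius large)) + (m ∸ length (map radius large)) * (m ∸ length (map radius large))
      ≤⟨ sum-size-Unique-< m (AllPairs.map⁺ (AllPairs.filter⁺ (nonTiny? p) distinct)) (All.map⁺ (All.filter⁺ (nonTiny? p) bs<m)) ⟩
    m * m ∎

nonTiny-count≤1+countNonTinyRight : ∀ {n} p {C} (R : RightHalfRun n C) → let open RightHalfRun R in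
  length (filter (nonTiny? p) (first ∷ rest)) ≤ suc (countNonTinyRight n p C)
nonTiny-count≤1+countNonTinyRight {n} p {C} R = Unique-⊆⇒length≤ unique ⊆first∷right
  where
  open RightHalfRun R
  unique : Unique (filter (nonTiny? p) (first ∷ rest))
  unique = AllPairs.map (λ r≢r′ b≡b′ → r≢r′ (cong radius b≡b′)) (AllPairs.filter⁺ (nonTiny? p) radii-distinct)
  ⊆first∷right : filter (nonTiny? p) (first ∷ rest) ⊆ first ∷ filter (nonTinyRight? n p) C
  ⊆first∷right b∈ with ∈-filter⁻ (nonTiny? p) b∈
  ... | here refl     , _     = here refl
  ... | there b∈rest , large = there (∈-filter⁺ (nonTinyRight? n p) (All.lookup members (there b∈rest))
                                        (large , All.lookup rest-right b∈rest))

lemma1 : (z p m n : ℕ) → 1 ≤ z → 1 ≤ p → n ≡ m * m → 16 * (z * z) * (p * p) < n →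
    (C : List Ball) → All (ValidBall n) C →
    AllPairs (λ a b → radius a ≢ radius b) C →
    All (λ b → radius b + 1 ≤ m) C →
    IsCover n C → IsSpecial n p C →
    z * p ≤ countNonTinyRight n p C
lemma1 z p m n 1≤z 1≤p refl big C valid distinct bounded _ special =
  s≤s⁻¹ (<-≤-trans zp<large (nonTiny-count≤1+countNonTinyRight p R))
  where
  2≤m*m : 2 ≤ m * m
  2≤m*m = ≤-trans (s≤s (*-mono-≤ (*-mono-≤ {y = 16} (s≤s z≤n) (*-mono-≤ 1≤z 1≤z)) (*-mono-≤ 1≤p 1≤p))) big
  R = special⇒rightHalfRun 2≤m*m valid distinct special
  open RightHalfRun R
  square : ∀ z p → 16 * (z * z) * (p * p) ≡ 4 * (z * p) * (4 * (z * p))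
  square = solve-∀
  radii<m : All (λ b → radius b < m) (first ∷ rest)
  radii<m = All.map (λ {b} b∈C → ≤-trans (≤-reflexive (+-comm 1 (radius b))) (All.lookup bounded b∈C)) members
  zp<large : z * p < length (filter (nonTiny? p) (first ∷ rest))
  zp<large = volume-bound⇒< (*-mono-≤ 1≤z 1≤p) (m≤n*m p z {{>-nonZero 1≤z}})
    (m*m<n*n⇒m<n (subst (_< m * m) (square z p) big)) half≤volume
    (volume+[m∸c]²≤p²+m² p m (first ∷ rest) radii-distinct radii<m)
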